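{- Let $G$ be the complete graph on the vertex set $\{0,1\}^2\setminus\{10\}=\{00,01,11\}$ (i.e. its edges are $\{00,01\},\{00,11\},\{01,11\}$). Then $$C_M(G)=\log_2\beta\approx 0.849,$$ where $\beta^{ -1}$ is the unique positive root of the equation $x+\frac{x^2}{1-x^2}=1$.
   Context: Let $H$ be a simple graph whose vertex set is $\{0,1\}^2$, the set of ordered pairs of binary symbols (written as strings $ab$), or a subset of it, and whose edges are unordered pairs of distinct vertices. Two sequences $\mathbf{x}=(x_1,\dots,x_n),\mathbf{y}=(y_1,\dots,y_n)\in\{0,1\}^n$ are called distinguishable for $H$ if there exists $i\in\{1,\dots,n-1\}$ such that $\{x_ix_{i+1},\,y_iy_{i+1}\}$ is an edge of $H$. Let $M(H,n)$ be the largest cardinality of a set $C\subseteq\{0,1\}^n$ any two distinct elements of which are distinguishable for $H$. The Shannon–Markov capacity of $H$ is $C_M(H)=\limsup_{n\to\infty}\frac1n\log_2 M(H,n)$. -}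

module Defs where

open import Data.Bool using (Bool; true; false)
open import Data.Nat as ℕ using (ℕ; zero; suc)
open import Data.Fin using (fromℕ<)
open import Data.Integer using (+_)
open import Data.Rational using (ℚ; _/_; _+_; _*_; _-_; _<_; 1ℚ)
open import Data.Vec using (Vec; lookup)
open import Data.List using (List; length)
open import Data.List.Relation.Unary.Unique.Propositional using (Unique)
open import Data.List.Relation.Unary.AllPairs using (AllPairs)
open import Data.Product using (_×_; _,_; Σ; ∃)
open import Relation.Binary.PropositionalEquality using (_≡_; _≢_)
open import Relation.Nullary using (¬_)

-- Vertices: ordered pairs of binary symbols, ab ↦ (a , b).
Vertex : Set
Vertex = Bool × Bool

-- A graph on (a subset of) {0,1}^2, given by its (symmetric, irreflexive) edge relation.
Graph : Set₁
Graph = Vertex → Vertex → Set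

G : Graph
G u v = (u ≢ (true , false)) × (v ≢ (true , false)) × (u ≢ v)

-- x and y in {0,1}^n are distinguishable for H: some i ∈ {1..n-1} (0-based: i, i+1 < n)
-- with {x_i x_{i+1}, y_i y_{i+1}} an edge of H.
Distinguishable : Graph → (n : ℕ) → Vec Bool n → Vec Bool n → Set
Distinguishable H n x y =
  ∃ λ (i : ℕ) → Σ (suc i ℕ.< n) λ p →
    H (lookup x (fromℕ< (ℕ.<-trans ℕ.≤-refl p)) , lookup x (fromℕ< p))
      (lookup y (fromℕ< (ℕ.<-trans ℕ.≤-refl p)) , lookup y (fromℕ< p))
  where import Data.Nat.Properties as ℕ

IsCode : Graph → (n : ℕ) → List (Vec Bool n) → Set
IsCode H n C = Unique C × AllPairs (Distinguishable H n) C

ℕ→ℚ : ℕ → ℚ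
ℕ→ℚ m = + m / 1

pow : ℚ → ℕ → ℚ
pow x zero = 1ℚ
pow x (suc n) = x * pow x n

-- x + x²/(1-x²) < 1, denominators cleared (valid for 0 < x < 1, where 1 - x² > 0)
BelowRoot : ℚ → Set
BelowRoot x = x * (1ℚ - x * x) + x * x < 1ℚ - x * x

-- x + x²/(1-x²) > 1, denominators cleared (valid for 0 < x < 1)
AboveRoot : ℚ → Set
AboveRoot x = 1ℚ - x * x < x * (1ℚ - x * x) + x * x

{-# OPTIONS --safe #-}
module Submission where

-- Since 10 is not a vertex of G, two words can only be told apart at a position where neither
-- of them reads 10. Sorting a code of length n + 2 by its first two symbols (?0, 01, 11) thus
-- bounds its size by M (n + 2) = M₀ n + 2 M n, where M₀ n bounds the codes of length n + 1
-- whose words all start with 0 and satisfies M₀ (n + 1) = M₀ n + M n; explicit codes attain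
-- both bounds. For 0 < x < 1 put u k = M k x^k, z k = M₀ k x^(k+1) and
-- Φ k = x z k + (1 - x) (u (k + 1) + u k). Then Φ 0 = 1 and Φ (k + 1) = Φ k + δ u k, where
-- δ = (1 - x²) (x + x²/(1 - x²) - 1).
-- If δ ≤ 0, Φ stays below 1, so (1 - x) |C| x^n ≤ 1 for every code C of length n; since the
-- powers of C are codes of lengths j n and sizes |C|^j, in fact |C| x^n ≤ 1.
-- If δ > 0, Φ grows at least linearly, so one of z k, u (k + 1), u k exceeds 1 for
-- arbitrarily large k, and the corresponding explicit code is the one required.

open import Defs
open import Data.Bool using (Bool; true; false)
open import Data.Empty using (⊥; ⊥-elim)
open import Data.List using (List; []; _∷_; [_]; length; map; _++_; mapMaybe; cartesianProductWith)
open import Data.List.Properties using (length-++; length-map)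
import Data.List.Relation.Unary.All as All
open All using (All; []; _∷_)
import Data.List.Relation.Unary.All.Properties as All
import Data.List.Relation.Unary.AllPairs as AllPairs
open AllPairs using (AllPairs; []; _∷_)
import Data.List.Relation.Unary.AllPairs.Properties as AllPairs
open import Data.Maybe using (Maybe; just; nothing)
open import Data.Product using (_×_; _,_; Σ; ∃)
open import Data.Sum using (_⊎_; inj₁; inj₂)
open import Data.Vec using (Vec; []; _∷_) renaming (_++_ to _++ᵥ_)
open import Function using (_∘_)
open import Relation.Binary.Core using (Rel)
open import Relation.Binary.PropositionalEquality
  using (_≡_; _≢_; refl; cong; cong₂; subst; sym; trans; setoid; module ≡-Reasoning)
open import Relation.Nullary using (¬_; yes; no)

module Codes where

  open import Data.Nat using (ℕ; zero; suc; _+_; _*_; _≤_; z≤n; s≤s)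
  open import Data.Nat.Properties using (+-mono-≤; +-suc; +-assoc; module ≤-Reasoning)

  private variable
    m n : ℕ
    H : Graph
    A B E : Set

  module _ {ℓ₁ ℓ₂ ℓ₃} {R : Rel A ℓ₁} {S : Rel B ℓ₂} {T : Rel E ℓ₃} (f : A → B → E)
           (f-resp : ∀ {x x′ y y′} → R x x′ → T (f x y) (f x′ y′))
           (f-respʳ : ∀ {x y y′} → S y y′ → T (f x y) (f x y′)) where

    AllPairs-cartesianProductWith⁺ : ∀ {xs ys} → AllPairs R xs → AllPairs S ys →
                                     AllPairs T (cartesianProductWith f xs ys)
    AllPairs-cartesianProductWith⁺ {[]}     []         Sys = []
    AllPairs-cartesianProductWith⁺ {x ∷ xs} {ys} (Rx ∷ Rxs) Sys =
      AllPairs.++⁺ (AllPairs.map⁺ (AllPairs.map f-respʳ Sys))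
                   (AllPairs-cartesianProductWith⁺ Rxs Sys)
                   (All.map⁺ (All.universal across ys))
      where
      across : ∀ y → All (T (f x y)) (cartesianProductWith f xs ys)
      across y = All.cartesianProductWith⁺ (setoid _) (setoid _) f xs ys
                   (λ x′∈xs _ → f-resp (All.lookup Rx x′∈xs))

  module _ {ℓ₁ ℓ₂} {R : Rel A ℓ₁} {S : Rel B ℓ₂} (f : A → Maybe B)
           (f-resp : ∀ {x y u v} → f x ≡ just u → f y ≡ just v → R x y → S u v) where

    private
      All-mapMaybe⁺ : ∀ {x u xs} → f x ≡ just u → All (R x) xs → All (S u) (mapMaybe f xs)
      All-mapMaybe⁺ fx≡u [] = []
      All-mapMaybe⁺ {xs = y ∷ _} fx≡u (r ∷ rs) with f y in fy≡v
      ... | just _  = f-resp fx≡u fy≡v r ∷ All-mapMaybe⁺ fx≡u rs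
      ... | nothing = All-mapMaybe⁺ fx≡u rs

    AllPairs-mapMaybe⁺ : ∀ {xs} → AllPairs R xs → AllPairs S (mapMaybe f xs)
    AllPairs-mapMaybe⁺ [] = []
    AllPairs-mapMaybe⁺ {x ∷ _} (r ∷ rs) with f x in fx≡u
    ... | just _  = All-mapMaybe⁺ fx≡u r ∷ AllPairs-mapMaybe⁺ rs
    ... | nothing = AllPairs-mapMaybe⁺ rs

  AllPairs-map-++⁺ : ∀ {ℓ} {R : Rel E ℓ} {f : A → E} {g : B → E} {xs ys} →
                     AllPairs (λ x y → R (f x) (f y)) xs → AllPairs (λ x y → R (g x) (g y)) ys →
                     (∀ x y → R (f x) (g y)) → AllPairs R (map f xs ++ map g ys)
  AllPairs-map-++⁺ {xs = xs} {ys} Rxs Rys across =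
    AllPairs.++⁺ (AllPairs.map⁺ Rxs) (AllPairs.map⁺ Rys)
                 (All.map⁺ (All.universal (λ x → All.map⁺ (All.universal (across x) ys)) xs))

  AllPairs-empty⇒length≤1 : ∀ {ℓ} {R : Rel A ℓ} → (∀ x y → ¬ R x y) → ∀ {xs} → AllPairs R xs → length xs ≤ 1
  AllPairs-empty⇒length≤1 R-empty {[]}        _             = z≤n
  AllPairs-empty⇒length≤1 R-empty {_ ∷ []}    _             = s≤s z≤n
  AllPairs-empty⇒length≤1 R-empty {x ∷ y ∷ _} ((r ∷ _) ∷ _) = ⊥-elim (R-empty x y r)

  length-map-++ : ∀ (f : A → E) (g : B → E) xs ys → length (map f xs ++ map g ys) ≡ length xs + length ys
  length-map-++ f g xs ys = trans (length-++ (map f xs)) (cong₂ _+_ (length-map f xs) (length-map g ys))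

  Apart : Graph → Vec Bool n → Vec Bool n → Set
  Apart H []          []          = ⊥
  Apart H (_ ∷ [])    (_ ∷ [])    = ⊥
  Apart H (a ∷ b ∷ x) (c ∷ d ∷ y) = H (a , b) (c , d) ⊎ Apart H (b ∷ x) (d ∷ y)

  distinguishable⇒apart : (x y : Vec Bool n) → Distinguishable H n x y → Apart H x y
  distinguishable⇒apart []          []          (_ , () , _)
  distinguishable⇒apart (_ ∷ [])    (_ ∷ [])    (_ , s≤s () , _)
  distinguishable⇒apart (a ∷ b ∷ x) (c ∷ d ∷ y) (zero  , _     , e) = inj₁ e
  distinguishable⇒apart (a ∷ b ∷ x) (c ∷ d ∷ y) (suc i , s≤s p , e) =
    inj₂ (distinguishable⇒apart (b ∷ x) (d ∷ y) (i , p , e))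

  apart⇒distinguishable : (x y : Vec Bool n) → Apart H x y → Distinguishable H n x y
  apart⇒distinguishable []          []          ()
  apart⇒distinguishable (_ ∷ [])    (_ ∷ [])    ()
  apart⇒distinguishable (a ∷ b ∷ x) (c ∷ d ∷ y) (inj₁ e) = zero , s≤s (s≤s z≤n) , e
  apart⇒distinguishable (a ∷ b ∷ x) (c ∷ d ∷ y) (inj₂ r)
    with i , p , e ← apart⇒distinguishable (b ∷ x) (d ∷ y) r = suc i , s≤s p , e

  apart-irrefl : (∀ u → ¬ H u u) → (x : Vec Bool n) → ¬ Apart H x x
  apart-irrefl H-irrefl (a ∷ b ∷ x) (inj₁ e) = H-irrefl (a , b) e
  apart-irrefl H-irrefl (a ∷ b ∷ x) (inj₂ r) = apart-irrefl H-irrefl (b ∷ x) r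

  apart⇒≢ : (∀ u → ¬ H u u) → {x y : Vec Bool n} → Apart H x y → x ≢ y
  apart⇒≢ H-irrefl r refl = apart-irrefl H-irrefl _ r

  isCode⇒apart : {C : List (Vec Bool n)} → IsCode H n C → AllPairs (Apart H) C
  isCode⇒apart (_ , distinguishable) = AllPairs.map (distinguishable⇒apart _ _) distinguishable

  apart⇒isCode : (∀ u → ¬ H u u) → {C : List (Vec Bool n)} → AllPairs (Apart H) C → IsCode H n C
  apart⇒isCode H-irrefl apart =
    AllPairs.map (apart⇒≢ H-irrefl) apart , AllPairs.map (apart⇒distinguishable _ _) apart

  apart-∷⁺ : ∀ a {x y : Vec Bool n} → Apart H x y → Apart H (a ∷ x) (a ∷ y)
  apart-∷⁺ a {[]}    {[]}    ()
  apart-∷⁺ a {_ ∷ _} {_ ∷ _} r = inj₂ r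

  apart-++ˡ : (x x′ : Vec Bool m) {y y′ : Vec Bool n} → Apart H x x′ → Apart H (x ++ᵥ y) (x′ ++ᵥ y′)
  apart-++ˡ []          []          ()
  apart-++ˡ (_ ∷ [])    (_ ∷ [])    ()
  apart-++ˡ (a ∷ b ∷ x) (c ∷ d ∷ x′) (inj₁ e) = inj₁ e
  apart-++ˡ (a ∷ b ∷ x) (c ∷ d ∷ x′) (inj₂ r) = inj₂ (apart-++ˡ (b ∷ x) (d ∷ x′) r)

  apart-++ʳ : (x : Vec Bool m) {y y′ : Vec Bool n} → Apart H y y′ → Apart H (x ++ᵥ y) (x ++ᵥ y′)
  apart-++ʳ []      r = r
  apart-++ʳ (a ∷ x) r = apart-∷⁺ a (apart-++ʳ x r)

  _⊗_ : List (Vec Bool m) → List (Vec Bool n) → List (Vec Bool (m + n))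
  _⊗_ = cartesianProductWith _++ᵥ_

  length-⊗ : (C : List (Vec Bool m)) (D : List (Vec Bool n)) → length (C ⊗ D) ≡ length C * length D
  length-⊗ []      D = refl
  length-⊗ (x ∷ C) D = begin
    length (map (x ++ᵥ_) D ++ C ⊗ D)          ≡⟨ length-++ (map (x ++ᵥ_) D) ⟩
    length (map (x ++ᵥ_) D) + length (C ⊗ D)  ≡⟨ cong₂ _+_ (length-map (x ++ᵥ_) D) (length-⊗ C D) ⟩
    length D + length C * length D            ∎
    where open ≡-Reasoning

  apart-⊗ : {C : List (Vec Bool m)} {D : List (Vec Bool n)} →
            AllPairs (Apart H) C → AllPairs (Apart H) D → AllPairs (Apart H) (C ⊗ D)
  apart-⊗ = AllPairs-cartesianProductWith⁺ _++ᵥ_ (apart-++ˡ _ _) (apart-++ʳ _)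

  power : List (Vec Bool n) → (j : ℕ) → List (Vec Bool (j * n))
  power C zero    = [ [] ]
  power C (suc j) = C ⊗ power C j

  apart-power : {C : List (Vec Bool n)} → AllPairs (Apart H) C → ∀ j → AllPairs (Apart H) (power C j)
  apart-power apart zero    = [] ∷ []
  apart-power apart (suc j) = apart-⊗ apart (apart-power apart j)

  G-irrefl : ∀ u → ¬ G u u
  G-irrefl u (_ , _ , u≢u) = u≢u refl

  Apart₀ : Vec Bool n → Vec Bool n → Set
  Apart₀ s t = Apart G (false ∷ s) (false ∷ t)

  apart-1∷⁻ : {s t : Vec Bool n} → Apart G (true ∷ s) (true ∷ t) → Apart G s t
  apart-1∷⁻ {s = []}        {[]}        ()
  apart-1∷⁻ {s = false ∷ _} {_ ∷ _}     (inj₁ (10≢10 , _)) = ⊥-elim (10≢10 refl)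
  apart-1∷⁻ {s = true ∷ _}  {false ∷ _} (inj₁ (_ , 10≢10 , _)) = ⊥-elim (10≢10 refl)
  apart-1∷⁻ {s = true ∷ _}  {true ∷ _}  (inj₁ (_ , _ , 11≢11)) = ⊥-elim (11≢11 refl)
  apart-1∷⁻ {s = _ ∷ _}     {_ ∷ _}     (inj₂ r) = r

  apart-?0∷⁻ : ∀ a b {s t : Vec Bool n} → Apart G (a ∷ false ∷ s) (b ∷ false ∷ t) → Apart₀ s t
  apart-?0∷⁻ true  b     (inj₁ (10≢10 , _)) = ⊥-elim (10≢10 refl)
  apart-?0∷⁻ false true  (inj₁ (_ , 10≢10 , _)) = ⊥-elim (10≢10 refl)
  apart-?0∷⁻ false false (inj₁ (_ , _ , 00≢00)) = ⊥-elim (00≢00 refl)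
  apart-?0∷⁻ a     b     (inj₂ r) = r

  apart-a1∷⁻ : ∀ a {s t : Vec Bool n} → Apart G (a ∷ true ∷ s) (a ∷ true ∷ t) → Apart G s t
  apart-a1∷⁻ a (inj₁ e) = ⊥-elim (G-irrefl _ e)
  apart-a1∷⁻ a (inj₂ r) = apart-1∷⁻ r

  rest-0 rest-1 : Vec Bool (suc n) → Maybe (Vec Bool n)
  rest-0 (false ∷ s) = just s
  rest-0 (true  ∷ _) = nothing
  rest-1 (true  ∷ s) = just s
  rest-1 (false ∷ _) = nothing

  rest-?0 rest-01 rest-11 : Vec Bool (suc (suc n)) → Maybe (Vec Bool n)
  rest-?0 (_ ∷ false ∷ s) = just s
  rest-?0 (_ ∷ true  ∷ _) = nothing
  rest-01 (false ∷ true  ∷ s) = just s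
  rest-01 (false ∷ false ∷ _) = nothing
  rest-01 (true  ∷ _     ∷ _) = nothing
  rest-11 (true  ∷ true  ∷ s) = just s
  rest-11 (true  ∷ false ∷ _) = nothing
  rest-11 (false ∷ _     ∷ _) = nothing

  length-split₁ : (C : List (Vec Bool (suc n))) →
                  length C ≡ length (mapMaybe rest-0 C) + length (mapMaybe rest-1 C)
  length-split₁ []                = refl
  length-split₁ ((false ∷ _) ∷ C) = cong suc (length-split₁ C)
  length-split₁ ((true  ∷ _) ∷ C) = trans (cong suc (length-split₁ C)) (sym (+-suc _ _))

  length-split₂ : (C : List (Vec Bool (suc (suc n)))) →
                  length C ≡ length (mapMaybe rest-?0 C) +
                             (length (mapMaybe rest-01 C) + length (mapMaybe rest-11 C))
  length-split₂ []                        = refl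
  length-split₂ ((false ∷ false ∷ _) ∷ C) = cong suc (length-split₂ C)
  length-split₂ ((true  ∷ false ∷ _) ∷ C) = cong suc (length-split₂ C)
  length-split₂ ((false ∷ true  ∷ _) ∷ C) = trans (cong suc (length-split₂ C)) (sym (+-suc _ _))
  length-split₂ ((true  ∷ true  ∷ _) ∷ C) =
    trans (cong suc (length-split₂ C))
          (sym (trans (cong (length (mapMaybe rest-?0 C) +_) (+-suc _ _)) (+-suc _ _)))

  apart₀-rest-0 : {x y : Vec Bool (suc n)} {s t : Vec Bool n} →
                  rest-0 x ≡ just s → rest-0 y ≡ just t → Apart₀ x y → Apart₀ s t
  apart₀-rest-0 {x = false ∷ _} {false ∷ _} refl refl r = apart-?0∷⁻ false false r
  apart₀-rest-0 {x = false ∷ _} {true  ∷ _} _    ()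
  apart₀-rest-0 {x = true  ∷ _} ()

  apart₀-rest-1 : {x y : Vec Bool (suc n)} {s t : Vec Bool n} →
                  rest-1 x ≡ just s → rest-1 y ≡ just t → Apart₀ x y → Apart G s t
  apart₀-rest-1 {x = true  ∷ _} {true  ∷ _} refl refl r = apart-a1∷⁻ false r
  apart₀-rest-1 {x = true  ∷ _} {false ∷ _} _    ()
  apart₀-rest-1 {x = false ∷ _} ()

  apart-rest-?0 : {x y : Vec Bool (suc (suc n))} {s t : Vec Bool n} →
                  rest-?0 x ≡ just s → rest-?0 y ≡ just t → Apart G x y → Apart₀ s t
  apart-rest-?0 {x = a ∷ false ∷ _} {b ∷ false ∷ _} refl refl r = apart-?0∷⁻ a b r
  apart-rest-?0 {x = _ ∷ false ∷ _} {_ ∷ true  ∷ _} _    ()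
  apart-rest-?0 {x = _ ∷ true  ∷ _} ()

  apart-rest-01 : {x y : Vec Bool (suc (suc n))} {s t : Vec Bool n} →
                  rest-01 x ≡ just s → rest-01 y ≡ just t → Apart G x y → Apart G s t
  apart-rest-01 {x = false ∷ true ∷ _} {false ∷ true  ∷ _} refl refl r = apart-a1∷⁻ false r
  apart-rest-01 {x = false ∷ true ∷ _} {false ∷ false ∷ _} _    ()
  apart-rest-01 {x = false ∷ true ∷ _} {true  ∷ _     ∷ _} _    ()
  apart-rest-01 {x = false ∷ false ∷ _} ()
  apart-rest-01 {x = true  ∷ _     ∷ _} ()

  apart-rest-11 : {x y : Vec Bool (suc (suc n))} {s t : Vec Bool n} →
                  rest-11 x ≡ just s → rest-11 y ≡ just t → Apart G x y → Apart G s t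
  apart-rest-11 {x = true ∷ true ∷ _} {true  ∷ true  ∷ _} refl refl r = apart-a1∷⁻ true r
  apart-rest-11 {x = true ∷ true ∷ _} {true  ∷ false ∷ _} _    ()
  apart-rest-11 {x = true ∷ true ∷ _} {false ∷ _     ∷ _} _    ()
  apart-rest-11 {x = true  ∷ false ∷ _} ()
  apart-rest-11 {x = false ∷ _     ∷ _} ()

  mutual
    M : ℕ → ℕ
    M zero          = 1
    M (suc zero)    = 1
    M (suc (suc n)) = M₀ n + (M n + M n)

    M₀ : ℕ → ℕ
    M₀ zero    = 1
    M₀ (suc n) = M₀ n + M n

  mutual
    length≤M : {C : List (Vec Bool n)} → AllPairs (Apart G) C → length C ≤ M n
    length≤M {zero}        = AllPairs-empty⇒length≤1 λ { [] [] () }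
    length≤M {suc zero}    = AllPairs-empty⇒length≤1 λ { (_ ∷ []) (_ ∷ []) () }
    length≤M {suc (suc n)} {C} apart = begin
      length C                                   ≡⟨ length-split₂ C ⟩
      length (mapMaybe rest-?0 C) +
        (length (mapMaybe rest-01 C) + length (mapMaybe rest-11 C))
        ≤⟨ +-mono-≤ (length≤M₀ (AllPairs-mapMaybe⁺ rest-?0 apart-rest-?0 apart))
            (+-mono-≤ (length≤M (AllPairs-mapMaybe⁺ rest-01 apart-rest-01 apart))
                      (length≤M (AllPairs-mapMaybe⁺ rest-11 apart-rest-11 apart))) ⟩
      M₀ n + (M n + M n)                         ∎
      where open ≤-Reasoning

    length≤M₀ : {S : List (Vec Bool n)} → AllPairs Apart₀ S → length S ≤ M₀ n
    length≤M₀ {zero}      = AllPairs-empty⇒length≤1 λ { [] [] () }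
    length≤M₀ {suc n} {S} apart = begin
      length S                                             ≡⟨ length-split₁ S ⟩
      length (mapMaybe rest-0 S) + length (mapMaybe rest-1 S)
        ≤⟨ +-mono-≤ (length≤M₀ (AllPairs-mapMaybe⁺ rest-0 apart₀-rest-0 apart))
                    (length≤M (AllPairs-mapMaybe⁺ rest-1 apart₀-rest-1 apart)) ⟩
      M₀ n + M n                                           ∎
      where open ≤-Reasoning

  mutual
    optimal : ∀ n → List (Vec Bool n)
    optimal zero          = [ [] ]
    optimal (suc zero)    = [ false ∷ [] ]
    optimal (suc (suc n)) = map (false ∷_) (optimal₀ (suc n)) ++ map (λ s → true ∷ true ∷ s) (optimal n)

    optimal₀ : ∀ n → List (Vec Bool n)
    optimal₀ zero    = [ [] ]
    optimal₀ (suc n) = map (false ∷_) (optimal₀ n) ++ map (true ∷_) (optimal n)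

  mutual
    length-optimal : ∀ n → length (optimal n) ≡ M n
    length-optimal zero          = refl
    length-optimal (suc zero)    = refl
    length-optimal (suc (suc n)) = begin
      length (optimal (suc (suc n)))                        ≡⟨ length-map-++ _ _ (optimal₀ (suc n)) (optimal n) ⟩
      length (optimal₀ (suc n)) + length (optimal n)        ≡⟨ cong₂ _+_ (length-optimal₀ (suc n)) (length-optimal n) ⟩
      (M₀ n + M n) + M n                                    ≡⟨ +-assoc (M₀ n) (M n) (M n) ⟩
      M₀ n + (M n + M n)                                    ∎
      where open ≡-Reasoning

    length-optimal₀ : ∀ n → length (optimal₀ n) ≡ M₀ n
    length-optimal₀ zero    = refl
    length-optimal₀ (suc n) = trans (length-map-++ _ _ (optimal₀ n) (optimal n))
                                    (cong₂ _+_ (length-optimal₀ n) (length-optimal n))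

  mutual
    apart-optimal : ∀ n → AllPairs (Apart G) (optimal n)
    apart-optimal zero          = [] ∷ []
    apart-optimal (suc zero)    = [] ∷ []
    apart-optimal (suc (suc n)) =
      AllPairs-map-++⁺ (apart₀-optimal₀ (suc n))
                       (AllPairs.map (apart-∷⁺ true ∘ apart-∷⁺ true) (apart-optimal n))
                       0?-apart-11
      where
      0?-apart-11 : ∀ (s : Vec Bool (suc n)) t → Apart G (false ∷ s) (true ∷ true ∷ t)
      0?-apart-11 (false ∷ _) _ = inj₁ ((λ ()) , (λ ()) , (λ ()))
      0?-apart-11 (true  ∷ _) _ = inj₁ ((λ ()) , (λ ()) , (λ ()))

    apart₀-optimal₀ : ∀ n → AllPairs Apart₀ (optimal₀ n)
    apart₀-optimal₀ zero    = [] ∷ []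
    apart₀-optimal₀ (suc n) =
      AllPairs-map-++⁺ (AllPairs.map inj₂ (apart₀-optimal₀ n))
                       (AllPairs.map (inj₂ ∘ apart-∷⁺ true) (apart-optimal n))
                       (λ _ _ → inj₁ ((λ ()) , (λ ()) , (λ ())))

open Codes

open import Data.Nat as ℕ using (ℕ; zero; suc; _≥_)
import Data.Nat.Properties as ℕ
open import Data.Nat.Coprimality using (Coprime; 1-coprimeTo)
import Data.Nat.Coprimality as Coprime
import Data.Integer as ℤ
import Data.Integer.Properties as ℤ
open import Data.Rational
  using (ℚ; mkℚ; 0ℚ; 1ℚ; _+_; _*_; _-_; -_; _≤_; _<_; _<?_; *≤*; *<*; nonNegative; nonPositive; positive)
open import Data.Rational.Properties
import Data.Rational.Unnormalised as ℚᵘ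
open import Data.Rational.Solver using (module +-*-Solver)
open import Algebra.Bundles using (CommutativeMonoid)
open import Algebra.Properties.CommutativeSemigroup
  (CommutativeMonoid.commutativeSemigroup *-1-commutativeMonoid) using (interchange)
open +-*-Solver

private variable
  m n : ℕ
  p q r : ℚ

0≤1 : 0ℚ ≤ 1ℚ
0≤1 = *≤* (ℤ.+≤+ ℕ.z≤n)

p≤p+q : ∀ p → 0ℚ ≤ q → p ≤ p + q
p≤p+q {q} p 0≤q = subst (_≤ p + q) (+-identityʳ p) (+-monoʳ-≤ p 0≤q)

p≤q+p : ∀ p → 0ℚ ≤ q → p ≤ q + p
p≤q+p {q} p 0≤q = subst (_≤ q + p) (+-identityˡ p) (+-monoˡ-≤ p 0≤q)

nonNeg*nonNeg : 0ℚ ≤ p → 0ℚ ≤ q → 0ℚ ≤ p * q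
nonNeg*nonNeg {p} {q} 0≤p 0≤q =
  nonNegative⁻¹ (p * q) {{nonNeg*nonNeg⇒nonNeg p {{nonNegative 0≤p}} q {{nonNegative 0≤q}}}}

pos*pos : 0ℚ < p → 0ℚ < q → 0ℚ < p * q
pos*pos {p} {q} 0<p 0<q = positive⁻¹ (p * q) {{pos*pos⇒pos p {{positive 0<p}} q {{positive 0<q}}}}

p≤1⇒p*q≤q : p ≤ 1ℚ → 0ℚ ≤ q → p * q ≤ q
p≤1⇒p*q≤q {p} {q} p≤1 0≤q = subst (p * q ≤_) (*-identityˡ q) (*-monoʳ-≤-nonNeg q {{nonNegative 0≤q}} p≤1)

p≤q⇒0≤q-p : p ≤ q → 0ℚ ≤ q - p
p≤q⇒0≤q-p {p} {q} p≤q = subst (_≤ q - p) (+-inverseʳ p) (+-monoˡ-≤ (- p) p≤q)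

p<q⇒0<q-p : p < q → 0ℚ < q - p
p<q⇒0<q-p {p} {q} p<q = subst (_< q - p) (+-inverseʳ p) (+-monoˡ-< (- p) p<q)

p<q⇒p-q≤0 : p < q → p - q ≤ 0ℚ
p<q⇒p-q≤0 {p} {q} p<q = subst (p - q ≤_) (+-inverseʳ q) (+-monoˡ-≤ (- q) (<⇒≤ p<q))

1+[1+1]<p+[q+r]⇒1<p⊎1<q⊎1<r : 1ℚ + (1ℚ + 1ℚ) < p + (q + r) → 1ℚ < p ⊎ 1ℚ < q ⊎ 1ℚ < r
1+[1+1]<p+[q+r]⇒1<p⊎1<q⊎1<r {p} {q} {r} 3<p+q+r with 1ℚ <? p | 1ℚ <? q | 1ℚ <? r
... | yes 1<p | _       | _       = inj₁ 1<p
... | no _    | yes 1<q | _       = inj₂ (inj₁ 1<q)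
... | no _    | no _    | yes 1<r = inj₂ (inj₂ 1<r)
... | no p≯1  | no q≯1  | no r≯1  = ⊥-elim (<-irrefl refl (<-≤-trans 3<p+q+r
  (+-mono-≤ (≮⇒≥ p≯1) (+-mono-≤ (≮⇒≥ q≯1) (≮⇒≥ r≯1)))))

ℕ→ℚ≡mkℚ : ∀ m → ℕ→ℚ m ≡ mkℚ (ℤ.+ m) 0 (Coprime.sym (1-coprimeTo m))
ℕ→ℚ≡mkℚ m = normalize-coprime _

ℕ→ℚ-+ : ∀ m n → ℕ→ℚ (m ℕ.+ n) ≡ ℕ→ℚ m + ℕ→ℚ n
ℕ→ℚ-+ m n rewrite ℕ→ℚ≡mkℚ m | ℕ→ℚ≡mkℚ n =
  /-cong (sym (cong₂ ℤ._+_ (ℤ.*-identityʳ (ℤ.+ m)) (ℤ.*-identityʳ (ℤ.+ n)))) refl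

ℕ→ℚ-* : ∀ m n → ℕ→ℚ (m ℕ.* n) ≡ ℕ→ℚ m * ℕ→ℚ n
ℕ→ℚ-* m n rewrite ℕ→ℚ≡mkℚ m | ℕ→ℚ≡mkℚ n = /-cong (ℤ.pos-* m n) refl

ℕ→ℚ-nonNeg : ∀ m → 0ℚ ≤ ℕ→ℚ m
ℕ→ℚ-nonNeg m = nonNegative⁻¹ (ℕ→ℚ m) {{normalize-nonNeg m 1}}

ℕ→ℚ-mono-≤ : m ℕ.≤ n → ℕ→ℚ m ≤ ℕ→ℚ n
ℕ→ℚ-mono-≤ {m} {n} m≤n rewrite ℕ→ℚ≡mkℚ m | ℕ→ℚ≡mkℚ n =
  *≤* (ℤ.*-monoʳ-≤-nonNeg (ℤ.+ 1) (ℤ.+≤+ m≤n))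

ℕ→ℚ[↧]*p≡↥ : ∀ n d-1 .(c : Coprime n (suc d-1)) → ℕ→ℚ (suc d-1) * mkℚ (ℤ.+ n) d-1 c ≡ ℕ→ℚ n
ℕ→ℚ[↧]*p≡↥ n d-1 c rewrite ℕ→ℚ≡mkℚ (suc d-1) =
  fromℚᵘ-cong {ℚᵘ.mkℚᵘ (ℤ.+ suc d-1 ℤ.* ℤ.+ n) (d-1 ℕ.+ 0)} {ℚᵘ.mkℚᵘ (ℤ.+ n) 0} (ℚᵘ.*≡* (begin
    (ℤ.+ suc d-1 ℤ.* ℤ.+ n) ℤ.* ℤ.+ 1  ≡⟨ ℤ.*-identityʳ _ ⟩
    ℤ.+ suc d-1 ℤ.* ℤ.+ n            ≡⟨ ℤ.*-comm (ℤ.+ suc d-1) (ℤ.+ n) ⟩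
    ℤ.+ n ℤ.* ℤ.+ suc d-1            ≡⟨ cong (λ k → ℤ.+ n ℤ.* ℤ.+ suc k) (sym (ℕ.+-identityʳ d-1)) ⟩
    ℤ.+ n ℤ.* ℤ.+ suc (d-1 ℕ.+ 0)    ∎))
  where open ≡-Reasoning

archimedean : ∀ c → 0ℚ < c → ∃ λ k → 1ℚ < ℕ→ℚ k * c
archimedean c@(mkℚ ℤ.+[1+ n ] d-1 _) 0<c = suc d-1 ℕ.+ 1 , (begin-strict
  1ℚ                            ≤⟨ ℕ→ℚ-mono-≤ {1} {suc n} (ℕ.s≤s ℕ.z≤n) ⟩
  ℕ→ℚ (suc n)                   ≡⟨ +-identityʳ _ ⟨
  ℕ→ℚ (suc n) + 0ℚ              <⟨ +-monoʳ-< (ℕ→ℚ (suc n)) 0<c ⟩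
  ℕ→ℚ (suc n) + c               ≡⟨ cong₂ _+_ (ℕ→ℚ[↧]*p≡↥ (suc n) d-1 _) (*-identityˡ c) ⟨
  ℕ→ℚ (suc d-1) * c + 1ℚ * c    ≡⟨ *-distribʳ-+ c (ℕ→ℚ (suc d-1)) 1ℚ ⟨
  (ℕ→ℚ (suc d-1) + 1ℚ) * c      ≡⟨ cong (_* c) (ℕ→ℚ-+ (suc d-1) 1) ⟨
  ℕ→ℚ (suc d-1 ℕ.+ 1) * c       ∎)
  where open ≤-Reasoning
archimedean (mkℚ ℤ.+0 _ _)       (*<* (ℤ.+<+ ()))
archimedean (mkℚ ℤ.-[1+ _ ] _ _) (*<* ())

pow-nonNeg : 0ℚ ≤ p → ∀ n → 0ℚ ≤ pow p n
pow-nonNeg 0≤p zero    = 0≤1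
pow-nonNeg 0≤p (suc n) = nonNeg*nonNeg 0≤p (pow-nonNeg 0≤p n)

pow-+ : ∀ p m n → pow p (m ℕ.+ n) ≡ pow p m * pow p n
pow-+ p zero    n = sym (*-identityˡ (pow p n))
pow-+ p (suc m) n = trans (cong (p *_) (pow-+ p m n)) (sym (*-assoc p (pow p m) (pow p n)))

bernoulli : 1ℚ ≤ r → ∀ n → 1ℚ + ℕ→ℚ n * (r - 1ℚ) ≤ pow r n
bernoulli {r} 1≤r zero    = ≤-reflexive (cong (1ℚ +_) (*-zeroˡ (r - 1ℚ)))
bernoulli {r} 1≤r (suc n) = begin
  1ℚ + ℕ→ℚ (suc n) * (r - 1ℚ)
    ≡⟨ cong (λ k → 1ℚ + k * (r - 1ℚ)) (ℕ→ℚ-+ 1 n) ⟩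
  1ℚ + (1ℚ + ℕ→ℚ n) * (r - 1ℚ)
    ≤⟨ p≤p+q _ (nonNeg*nonNeg (nonNeg*nonNeg (ℕ→ℚ-nonNeg n) 0≤r-1) 0≤r-1) ⟩
  1ℚ + (1ℚ + ℕ→ℚ n) * (r - 1ℚ) + ℕ→ℚ n * (r - 1ℚ) * (r - 1ℚ)
    ≡⟨ expand (ℕ→ℚ n) r ⟩
  r * (1ℚ + ℕ→ℚ n * (r - 1ℚ))
    ≤⟨ *-monoˡ-≤-nonNeg r {{nonNegative (≤-trans 0≤1 1≤r)}} (bernoulli 1≤r n) ⟩
  r * pow r n
    ∎
  where
  open ≤-Reasoning
  0≤r-1 = p≤q⇒0≤q-p 1≤r
  expand : ∀ a r → 1ℚ + (1ℚ + a) * (r - 1ℚ) + a * (r - 1ℚ) * (r - 1ℚ) ≡ r * (1ℚ + a * (r - 1ℚ))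
  expand = solve 2 (λ a r → con 1ℚ :+ (con 1ℚ :+ a) :* (r :- con 1ℚ) :+ a :* (r :- con 1ℚ) :* (r :- con 1ℚ)
                            := r :* (con 1ℚ :+ a :* (r :- con 1ℚ))) refl

bounded-powers⇒≤1 : ∀ {c} → 0ℚ < c → (∀ j → c * pow r j ≤ 1ℚ) → r ≤ 1ℚ
bounded-powers⇒≤1 {r} {c} 0<c bounded = ≮⇒≥ r≯1
  where
  r≯1 : ¬ (1ℚ < r)
  r≯1 1<r with j , 1<j*c[r-1] ← archimedean (c * (r - 1ℚ)) (pos*pos 0<c (p<q⇒0<q-p 1<r)) =
    <-irrefl refl (<-≤-trans 1<c*r^j (bounded j))
    where
    open ≤-Reasoning
    factor : ∀ c a r → c + a * (c * (r - 1ℚ)) ≡ c * (1ℚ + a * (r - 1ℚ))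
    factor = solve 3 (λ c a r → c :+ a :* (c :* (r :- con 1ℚ)) := c :* (con 1ℚ :+ a :* (r :- con 1ℚ))) refl
    1<c*r^j : 1ℚ < c * pow r j
    1<c*r^j = begin-strict
      1ℚ                               <⟨ 1<j*c[r-1] ⟩
      ℕ→ℚ j * (c * (r - 1ℚ))           ≤⟨ p≤q+p _ (<⇒≤ 0<c) ⟩
      c + ℕ→ℚ j * (c * (r - 1ℚ))       ≡⟨ factor c (ℕ→ℚ j) r ⟩
      c * (1ℚ + ℕ→ℚ j * (r - 1ℚ))      ≤⟨ *-monoˡ-≤-nonNeg c {{nonNegative (<⇒≤ 0<c)}} (bernoulli (<⇒≤ 1<r) j) ⟩
      c * pow r j                       ∎

weight : ℚ → List (Vec Bool n) → ℚ
weight {n} x C = ℕ→ℚ (length C) * pow x n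

weight-⊗ : ∀ x (C : List (Vec Bool m)) (D : List (Vec Bool n)) → weight x (C ⊗ D) ≡ weight x C * weight x D
weight-⊗ {m} {n} x C D = begin
  ℕ→ℚ (length (C ⊗ D)) * pow x (m ℕ.+ n)
    ≡⟨ cong₂ _*_ (cong ℕ→ℚ (length-⊗ C D)) (pow-+ x m n) ⟩
  ℕ→ℚ (length C ℕ.* length D) * (pow x m * pow x n)
    ≡⟨ cong (_* _) (ℕ→ℚ-* (length C) (length D)) ⟩
  ℕ→ℚ (length C) * ℕ→ℚ (length D) * (pow x m * pow x n)
    ≡⟨ interchange (ℕ→ℚ (length C)) (ℕ→ℚ (length D)) (pow x m) (pow x n) ⟩
  ℕ→ℚ (length C) * pow x m * (ℕ→ℚ (length D) * pow x n)
    ∎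
  where open ≡-Reasoning

weight-power : ∀ x (C : List (Vec Bool n)) j → weight x (power C j) ≡ pow (weight x C) j
weight-power x C zero    = *-identityˡ 1ℚ
weight-power x C (suc j) = trans (weight-⊗ x C (power C j)) (cong (weight x C *_) (weight-power x C j))

module Potential (x : ℚ) where

  u z : ℕ → ℚ
  u k = ℕ→ℚ (M k) * pow x k
  z k = ℕ→ℚ (M₀ k) * pow x (suc k)

  -- The linear form in (z k, u (k + 1), u k) left invariant by the recurrences of M and M₀
  -- exactly when x = 1/β.
  Φ : ℕ → ℚ
  Φ k = x * z k + (1ℚ - x) * (u (suc k) + u k)

  δ : ℚ
  δ = x * (1ℚ - x * x) + x * x - (1ℚ - x * x)

  z-suc : ∀ k → z (suc k) ≡ x * z k + x * x * u k
  z-suc k = begin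
    ℕ→ℚ (M₀ k ℕ.+ M k) * pow x (2 ℕ.+ k)          ≡⟨ cong (_* pow x (2 ℕ.+ k)) (ℕ→ℚ-+ (M₀ k) (M k)) ⟩
    (ℕ→ℚ (M₀ k) + ℕ→ℚ (M k)) * (x * (x * pow x k)) ≡⟨ expand (ℕ→ℚ (M₀ k)) (ℕ→ℚ (M k)) x (pow x k) ⟩
    x * z k + x * x * u k                           ∎
    where
    open ≡-Reasoning
    expand : ∀ a b x p → (a + b) * (x * (x * p)) ≡ x * (a * (x * p)) + x * x * (b * p)
    expand = solve 4 (λ a b x p → (a :+ b) :* (x :* (x :* p)) := x :* (a :* (x :* p)) :+ x :* x :* (b :* p)) refl

  u-suc-suc : ∀ k → u (2 ℕ.+ k) ≡ x * z k + x * x * (u k + u k)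
  u-suc-suc k = begin
    ℕ→ℚ (M₀ k ℕ.+ (M k ℕ.+ M k)) * pow x (2 ℕ.+ k)                 ≡⟨ cong (_* pow x (2 ℕ.+ k)) M-as-ℚ ⟩
    (ℕ→ℚ (M₀ k) + (ℕ→ℚ (M k) + ℕ→ℚ (M k))) * (x * (x * pow x k))  ≡⟨ expand (ℕ→ℚ (M₀ k)) (ℕ→ℚ (M k)) x (pow x k) ⟩
    x * z k + x * x * (u k + u k)                                   ∎
    where
    open ≡-Reasoning
    M-as-ℚ = trans (ℕ→ℚ-+ (M₀ k) (M k ℕ.+ M k)) (cong (ℕ→ℚ (M₀ k) +_) (ℕ→ℚ-+ (M k) (M k)))
    expand : ∀ a b x p → (a + (b + b)) * (x * (x * p)) ≡ x * (a * (x * p)) + x * x * (b * p + b * p)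
    expand = solve 4 (λ a b x p → (a :+ (b :+ b)) :* (x :* (x :* p))
                                  := x :* (a :* (x :* p)) :+ x :* x :* (b :* p :+ b :* p)) refl

  Φ-zero : Φ 0 ≡ 1ℚ
  Φ-zero = solve 1 (λ x → x :* (con 1ℚ :* (x :* con 1ℚ)) :+ (con 1ℚ :- x) :* (con 1ℚ :* (x :* con 1ℚ) :+ con 1ℚ :* con 1ℚ)
                          := con 1ℚ) refl x

  Φ-suc : ∀ k → Φ (suc k) ≡ Φ k + δ * u k
  Φ-suc k = begin
    x * z (suc k) + (1ℚ - x) * (u (2 ℕ.+ k) + u (suc k))
      ≡⟨ cong₂ (λ a b → x * a + (1ℚ - x) * (b + u (suc k))) (z-suc k) (u-suc-suc k) ⟩
    x * (x * z k + x * x * u k) + (1ℚ - x) * (x * z k + x * x * (u k + u k) + u (suc k))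
      ≡⟨ rearrange x (z k) (u k) (u (suc k)) ⟩
    Φ k + δ * u k
      ∎
    where
    open ≡-Reasoning
    rearrange : ∀ x z u u′ →
      x * (x * z + x * x * u) + (1ℚ - x) * (x * z + x * x * (u + u) + u′) ≡
      x * z + (1ℚ - x) * (u′ + u) + (x * (1ℚ - x * x) + x * x - (1ℚ - x * x)) * u
    rearrange = solve 4 (λ x z u u′ →
      x :* (x :* z :+ x :* x :* u) :+ (con 1ℚ :- x) :* (x :* z :+ x :* x :* (u :+ u) :+ u′) :=
      x :* z :+ (con 1ℚ :- x) :* (u′ :+ u) :+ (x :* (con 1ℚ :- x :* x) :+ x :* x :- (con 1ℚ :- x :* x)) :* u) refl

  Φ-suc-suc : ∀ k → Φ (2 ℕ.+ k) ≡ Φ k + δ * (u (suc k) + u k)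
  Φ-suc-suc k = begin
    Φ (2 ℕ.+ k)                         ≡⟨ Φ-suc (suc k) ⟩
    Φ (suc k) + δ * u (suc k)           ≡⟨ cong (_+ δ * u (suc k)) (Φ-suc k) ⟩
    Φ k + δ * u k + δ * u (suc k)       ≡⟨ +-assoc (Φ k) _ _ ⟩
    Φ k + (δ * u k + δ * u (suc k))     ≡⟨ cong (Φ k +_) (+-comm (δ * u k) (δ * u (suc k))) ⟩
    Φ k + (δ * u (suc k) + δ * u k)     ≡⟨ cong (Φ k +_) (*-distribˡ-+ δ (u (suc k)) (u k)) ⟨
    Φ k + δ * (u (suc k) + u k)         ∎
    where open ≡-Reasoning

  weight-optimal : ∀ k → weight x (optimal k) ≡ u k
  weight-optimal k = cong (λ l → ℕ→ℚ l * pow x k) (length-optimal k)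

  weight-optimal₀ : ∀ k → weight x (map (false ∷_) (optimal₀ k)) ≡ z k
  weight-optimal₀ k = cong (λ l → ℕ→ℚ l * pow x (suc k)) (trans (length-map (false ∷_) (optimal₀ k)) (length-optimal₀ k))

  module _ (0≤x : 0ℚ ≤ x) (x≤1 : x ≤ 1ℚ) where

    u-nonNeg : ∀ k → 0ℚ ≤ u k
    u-nonNeg k = nonNeg*nonNeg (ℕ→ℚ-nonNeg (M k)) (pow-nonNeg 0≤x k)

    z-nonNeg : ∀ k → 0ℚ ≤ z k
    z-nonNeg k = nonNeg*nonNeg (ℕ→ℚ-nonNeg (M₀ k)) (pow-nonNeg 0≤x (suc k))

    weight≤u : {C : List (Vec Bool n)} → AllPairs (Apart G) C → weight x C ≤ u n
    weight≤u {n} apart = *-monoʳ-≤-nonNeg (pow x n) {{nonNegative (pow-nonNeg 0≤x n)}} (ℕ→ℚ-mono-≤ (length≤M apart))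

    [1-x]u≤Φ : ∀ k → (1ℚ - x) * u k ≤ Φ k
    [1-x]u≤Φ k = begin
      (1ℚ - x) * u k                              ≤⟨ *-monoˡ-≤-nonNeg (1ℚ - x) {{nonNegative (p≤q⇒0≤q-p x≤1)}}
                                                        (p≤q+p (u k) (u-nonNeg (suc k))) ⟩
      (1ℚ - x) * (u (suc k) + u k)                ≤⟨ p≤q+p _ (nonNeg*nonNeg 0≤x (z-nonNeg k)) ⟩
      Φ k                                         ∎
      where open ≤-Reasoning

    Φ≤1 : δ ≤ 0ℚ → ∀ k → Φ k ≤ 1ℚ
    Φ≤1 δ≤0 zero    = ≤-reflexive Φ-zero
    Φ≤1 δ≤0 (suc k) = begin
      Φ (suc k)       ≡⟨ Φ-suc k ⟩
      Φ k + δ * u k   ≤⟨ +-monoʳ-≤ (Φ k) δu≤0 ⟩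
      Φ k + 0ℚ        ≡⟨ +-identityʳ (Φ k) ⟩
      Φ k             ≤⟨ Φ≤1 δ≤0 k ⟩
      1ℚ              ∎
      where
      open ≤-Reasoning
      δu≤0 = nonPositive⁻¹ (δ * u k) {{nonPos*nonNeg⇒nonPos δ {{nonPositive δ≤0}} (u k) {{nonNegative (u-nonNeg k)}}}}

    1≤Φ : 0ℚ ≤ δ → ∀ k → 1ℚ ≤ Φ k
    1≤Φ 0≤δ zero    = ≤-reflexive (sym Φ-zero)
    1≤Φ 0≤δ (suc k) = begin
      1ℚ             ≤⟨ 1≤Φ 0≤δ k ⟩
      Φ k            ≤⟨ p≤p+q (Φ k) (nonNeg*nonNeg 0≤δ (u-nonNeg k)) ⟩
      Φ k + δ * u k  ≡⟨ Φ-suc k ⟨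
      Φ (suc k)      ∎
      where open ≤-Reasoning

    Φ≤z+u+u : ∀ k → Φ k ≤ z k + (u (suc k) + u k)
    Φ≤z+u+u k =
      +-mono-≤ (p≤1⇒p*q≤q x≤1 (z-nonNeg k)) (p≤1⇒p*q≤q 1-x≤1 (+-mono-≤ (u-nonNeg (suc k)) (u-nonNeg k)))
      where
      1-x≤1 : 1ℚ - x ≤ 1ℚ
      1-x≤1 = +-monoʳ-≤ 1ℚ (neg-antimono-≤ 0≤x)

    x²≤u+u : 0ℚ ≤ δ → ∀ k → x * x ≤ u (2 ℕ.+ k) + u (suc k)
    x²≤u+u 0≤δ k = begin
      x * x                                           ≡⟨ *-identityʳ (x * x) ⟨
      x * x * 1ℚ                                      ≤⟨ *-monoˡ-≤-nonNeg (x * x) {{nonNegative 0≤x²}}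
                                                           (≤-trans (1≤Φ 0≤δ k) (Φ≤z+u+u k)) ⟩
      x * x * (z k + (u (suc k) + u k))               ≡⟨ distribute x (z k) (u k) (u (suc k)) ⟩
      x * (x * z k) + x * x * u k + x * x * u (suc k)
        ≤⟨ +-mono-≤ (+-mono-≤ (p≤1⇒p*q≤q x≤1 (nonNeg*nonNeg 0≤x (z-nonNeg k)))
                              (*-monoˡ-≤-nonNeg (x * x) {{nonNegative 0≤x²}} (p≤p+q (u k) (u-nonNeg k))))
                    (p≤1⇒p*q≤q x²≤1 (u-nonNeg (suc k))) ⟩
      x * z k + x * x * (u k + u k) + u (suc k)       ≡⟨ cong (_+ u (suc k)) (u-suc-suc k) ⟨
      u (2 ℕ.+ k) + u (suc k)                         ∎
      where
      open ≤-Reasoning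
      0≤x² = nonNeg*nonNeg 0≤x 0≤x
      x²≤1 = ≤-trans (p≤1⇒p*q≤q x≤1 0≤x) x≤1
      distribute : ∀ x z u u′ → x * x * (z + (u′ + u)) ≡ x * (x * z) + x * x * u + x * x * u′
      distribute = solve 4 (λ x z u u′ → x :* x :* (z :+ (u′ :+ u)) := x :* (x :* z) :+ x :* x :* u :+ x :* x :* u′) refl

    Φ-growth-step : 0ℚ ≤ δ → ∀ k → Φ (suc k) + δ * (x * x) ≤ Φ (3 ℕ.+ k)
    Φ-growth-step 0≤δ k = begin
      Φ (suc k) + δ * (x * x)                     ≤⟨ +-monoʳ-≤ (Φ (suc k))
                                                        (*-monoˡ-≤-nonNeg δ {{nonNegative 0≤δ}} (x²≤u+u 0≤δ k)) ⟩
      Φ (suc k) + δ * (u (2 ℕ.+ k) + u (suc k))   ≡⟨ Φ-suc-suc (suc k) ⟨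
      Φ (3 ℕ.+ k)                                 ∎
      where open ≤-Reasoning

    Φ-growth : 0ℚ ≤ δ → ∀ j → 1ℚ + ℕ→ℚ j * (δ * (x * x)) ≤ Φ (suc (j ℕ.* 2))
    Φ-growth 0≤δ zero    = ≤-trans (≤-reflexive (cong (1ℚ +_) (*-zeroˡ (δ * (x * x))))) (1≤Φ 0≤δ 1)
    Φ-growth 0≤δ (suc j) = begin
      1ℚ + ℕ→ℚ (suc j) * c                ≡⟨ cong (λ t → 1ℚ + t * c) (ℕ→ℚ-+ 1 j) ⟩
      1ℚ + (1ℚ + ℕ→ℚ j) * c               ≡⟨ shift (ℕ→ℚ j) c ⟩
      1ℚ + ℕ→ℚ j * c + c                  ≤⟨ +-monoˡ-≤ c (Φ-growth 0≤δ j) ⟩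
      Φ (suc (j ℕ.* 2)) + c                ≤⟨ Φ-growth-step 0≤δ (j ℕ.* 2) ⟩
      Φ (suc (suc j ℕ.* 2))                ∎
      where
      open ≤-Reasoning
      c = δ * (x * x)
      shift : ∀ a c → 1ℚ + (1ℚ + a) * c ≡ 1ℚ + a * c + c
      shift = solve 2 (λ a c → con 1ℚ :+ (con 1ℚ :+ a) :* c := con 1ℚ :+ a :* c :+ c) refl

  weight≤1 : 0ℚ ≤ x → x < 1ℚ → δ ≤ 0ℚ → {C : List (Vec Bool n)} → AllPairs (Apart G) C → weight x C ≤ 1ℚ
  weight≤1 {n} 0≤x x<1 δ≤0 {C} apart = bounded-powers⇒≤1 (p<q⇒0<q-p x<1) [1-x]weight^j≤1
    where
    open ≤-Reasoning
    x≤1 = <⇒≤ x<1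
    [1-x]weight^j≤1 : ∀ j → (1ℚ - x) * pow (weight x C) j ≤ 1ℚ
    [1-x]weight^j≤1 j = begin
      (1ℚ - x) * pow (weight x C) j     ≡⟨ cong ((1ℚ - x) *_) (weight-power x C j) ⟨
      (1ℚ - x) * weight x (power C j)   ≤⟨ *-monoˡ-≤-nonNeg (1ℚ - x) {{nonNegative (p≤q⇒0≤q-p x≤1)}}
                                             (weight≤u 0≤x x≤1 (apart-power apart j)) ⟩
      (1ℚ - x) * u (j ℕ.* n)            ≤⟨ [1-x]u≤Φ 0≤x x≤1 (j ℕ.* n) ⟩
      Φ (j ℕ.* n)                       ≤⟨ Φ≤1 0≤x x≤1 δ≤0 (j ℕ.* n) ⟩
      1ℚ                                ∎

  code-of-weight≥1 : ∀ k → 1ℚ < z k ⊎ 1ℚ < u (suc k) ⊎ 1ℚ < u k →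
                     ∃ λ n → k ℕ.≤ n × Σ (List (Vec Bool n)) λ C → IsCode G n C × 1ℚ ≤ weight x C
  code-of-weight≥1 k (inj₁ 1<z) =
    suc k , ℕ.n≤1+n k , map (false ∷_) (optimal₀ k) ,
    apart⇒isCode G-irrefl (AllPairs.map⁺ (apart₀-optimal₀ k)) ,
    subst (1ℚ ≤_) (sym (weight-optimal₀ k)) (<⇒≤ 1<z)
  code-of-weight≥1 k (inj₂ (inj₁ 1<u)) =
    suc k , ℕ.n≤1+n k , optimal (suc k) , apart⇒isCode G-irrefl (apart-optimal (suc k)) ,
    subst (1ℚ ≤_) (sym (weight-optimal (suc k))) (<⇒≤ 1<u)
  code-of-weight≥1 k (inj₂ (inj₂ 1<u)) =
    k , ℕ.≤-refl , optimal k , apart⇒isCode G-irrefl (apart-optimal k) ,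
    subst (1ℚ ≤_) (sym (weight-optimal k)) (<⇒≤ 1<u)

  module _ (0<x : 0ℚ < x) (x≤1 : x ≤ 1ℚ) (0<δ : 0ℚ < δ) where

    0<δx² : 0ℚ < δ * (x * x)
    0<δx² = pos*pos 0<δ (pos*pos 0<x 0<x)

    exceeds-1-beyond : ∀ N → ∃ λ k → N ℕ.≤ k × (1ℚ < z k ⊎ 1ℚ < u (suc k) ⊎ 1ℚ < u k)
    exceeds-1-beyond N with J , 1<J*c ← archimedean (δ * (x * x)) 0<δx² =
      k , N≤k , 1+[1+1]<p+[q+r]⇒1<p⊎1<q⊎1<r 3<z+u+u
      where
      c = δ * (x * x)
      j = J ℕ.+ J ℕ.+ N
      k = suc (j ℕ.* 2)
      N≤k : N ℕ.≤ k
      N≤k = ℕ.m≤n⇒m≤1+n (ℕ.≤-trans (ℕ.m≤n+m N (J ℕ.+ J)) (ℕ.m≤m*n j 2))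
      0≤x = <⇒≤ 0<x
      3<z+u+u : 1ℚ + (1ℚ + 1ℚ) < z k + (u (suc k) + u k)
      3<z+u+u = begin-strict
        1ℚ + (1ℚ + 1ℚ)                   <⟨ +-monoʳ-< 1ℚ (+-mono-< 1<J*c 1<J*c) ⟩
        1ℚ + (ℕ→ℚ J * c + ℕ→ℚ J * c)     ≡⟨ cong (1ℚ +_) (*-distribʳ-+ c (ℕ→ℚ J) (ℕ→ℚ J)) ⟨
        1ℚ + (ℕ→ℚ J + ℕ→ℚ J) * c         ≡⟨ cong (λ t → 1ℚ + t * c) (ℕ→ℚ-+ J J) ⟨
        1ℚ + ℕ→ℚ (J ℕ.+ J) * c           ≤⟨ +-monoʳ-≤ 1ℚ (*-monoʳ-≤-nonNeg c {{nonNegative (<⇒≤ 0<δx²)}}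
                                              (ℕ→ℚ-mono-≤ (ℕ.m≤m+n (J ℕ.+ J) N))) ⟩
        1ℚ + ℕ→ℚ j * c                   ≤⟨ Φ-growth 0≤x x≤1 (<⇒≤ 0<δ) j ⟩
        Φ k                              ≤⟨ Φ≤z+u+u 0≤x x≤1 k ⟩
        z k + (u (suc k) + u k)            ∎
        where open ≤-Reasoning

    weight≥1-beyond : ∀ N → ∃ λ n → n ≥ N × Σ (List (Vec Bool n)) λ C → IsCode G n C × 1ℚ ≤ weight x C
    weight≥1-beyond N =
      let k , N≤k , exceeds = exceeds-1-beyond N
          n , k≤n , code    = code-of-weight≥1 k exceeds
      in  n , ℕ.≤-trans N≤k k≤n , code

theorem2 : ((x : ℚ) → 0ℚ < x → x < 1ℚ → BelowRoot x →
      ∃ λ (N : ℕ) → (n : ℕ) → n ≥ N → (C : List (Vec Bool n)) → IsCode G n C →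
        ℕ→ℚ (length C) * pow x n ≤ 1ℚ)
    ×
    ((x : ℚ) → 0ℚ < x → x < 1ℚ → AboveRoot x →
      (N : ℕ) → ∃ λ (n : ℕ) → n ≥ N × Σ (List (Vec Bool n)) λ C → IsCode G n C ×
        1ℚ ≤ ℕ→ℚ (length C) * pow x n)
theorem2 =
  (λ x 0<x x<1 below → 0 , λ _ _ _ code →
     Potential.weight≤1 x (<⇒≤ 0<x) x<1 (p<q⇒p-q≤0 below) (isCode⇒apart code)) ,
  (λ x 0<x x<1 above → Potential.weight≥1-beyond x 0<x (<⇒≤ x<1) (p<q⇒0<q-p above))
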